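{- Let $\mathcal{B}$ be any hyperplane arrangement defined over $\mathbb{Q}$. Then $\mathcal{B}$ is a minor of the resonance arrangement $\mathcal{A}_n$ for some large enough $n$, i.e. $\mathcal{B}$ arises from $\mathcal{A}_n$ after a suitable finite sequence of restriction and contraction steps. Equivalently, every matroid that is representable over $\mathbb{Q}$ is (isomorphic to) a minor of the matroid underlying $\mathcal{A}_n$ for some large enough $n$.
   Context: For $n\ge 1$ the resonance arrangement is $\mathcal{A}_n=\{H_I \mid \emptyset\neq I\subseteq[n]\}$ in $\mathbb{R}^n$, where $H_I=\{x\in\mathbb{R}^n : \sum_{i\in I}x_i=0\}$. The matroid $M(\mathcal{A})$ underlying a (central) hyperplane arrangement $\mathcal{A}$ has ground set $\mathcal{A}$, and a subset is independent iff the normal vectors of its hyperplanes are linearly independent (equivalently the hyperplanes intersect in codimension equal to the cardinality of the subset); for $\mathcal{A}_n$ the normal vector of $H_I$ is the characteristic vector $\chi_I\in\{0,1\}^n$. A matroid is representable over a field $\mathbb{F}$ if it is the matroid of linear independence of the columns of some matrix over $\mathbb{F}$. For a matroid $M=(E,\mathcal{I})$ and $S\subseteq E$: the restriction $M|S$ has ground set $S$ and independent sets $\{I\in\mathcal{I}: I\subseteq S\}$; if $S$ is independent, the contraction $M/S$ has ground set $E\setminus S$ and independent sets $\{I\subseteq E\setminus S : I\cup S\in\mathcal{I}\}$. A minor of $M$ is a matroid obtained from $M$ by a finite sequence of restrictions and contractions. An arrangement $\mathcal{B}$ is a minor of $\mathcal{A}$ if $M(\mathcal{B})$ is a minor of $M(\mathcal{A})$.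 -}

module Defs where

open import Data.Bool using (Bool; true; false; T; not; _∧_; _∨_; if_then_else_)
open import Data.Unit using (⊤; tt)
open import Data.Nat using (ℕ)
open import Data.Fin using (Fin)
open import Data.Vec using (Vec; []; _∷_; lookup)
open import Data.Product using (Σ; _,_; proj₁; proj₂; ∃-syntax; Σ-syntax; _×_)
open import Data.List using (List; []; _∷_; foldr; map)
open import Data.List.Relation.Unary.All using (All)
open import Data.List.Relation.Unary.Unique.Propositional using (Unique)
open import Data.Rational using (ℚ; 0ℚ; 1ℚ; _+_; _*_)
open import Relation.Binary.PropositionalEquality using (_≡_)
open import Function.Bundles using (_↔_; Inverse; _⇔_)

Subset′ : Set → Set
Subset′ E = E → Bool

record SetSystem : Set₁ where
  field
    Carrier : Set
    Indep   : Subset′ Carrier → Set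
open SetSystem public

lincomb : {E : Set} {d : ℕ} → (E → Fin d → ℚ) → (E → ℚ) → List E → Fin d → ℚ
lincomb v c l i = foldr _+_ 0ℚ (map (λ e → c e * v e i) l)

LinIndep : {E : Set} {d : ℕ} → (E → Fin d → ℚ) → Subset′ E → Set
LinIndep {E} v I =
  (l : List E) → Unique l → All (λ e → T (I e)) l →
  (c : E → ℚ) → (∀ i → lincomb v c l i ≡ 0ℚ) → All (λ e → c e ≡ 0ℚ) l

vecMatroid : {E : Set} {d : ℕ} → (E → Fin d → ℚ) → SetSystem
vecMatroid {E} v = record { Carrier = E ; Indep = LinIndep v }

repMatroid : (d m : ℕ) → (Fin m → Fin d → ℚ) → SetSystem
repMatroid d m v = vecMatroid v

ext : (b : Bool) → (T b → Bool) → Bool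
ext true  f = f tt
ext false f = false

restrict : (M : SetSystem) → Subset′ (Carrier M) → SetSystem
restrict M S = record
  { Carrier = Σ (Carrier M) (λ e → T (S e))
  ; Indep   = λ I → Indep M (λ e → ext (S e) (λ t → I (e , t)))
  }

-- M / S  (only formed when S is independent, see Minor below)
contract : (M : SetSystem) → Subset′ (Carrier M) → SetSystem
contract M S = record
  { Carrier = Σ (Carrier M) (λ e → T (not (S e)))
  ; Indep   = λ I → Indep M (λ e → S e ∨ ext (not (S e)) (λ t → I (e , t)))
  }

data Minor (M : SetSystem) : SetSystem → Set₁ where
  here  : Minor M M
  res   : {N : SetSystem} → Minor M N → (S : Subset′ (Carrier N)) →
          Minor M (restrict N S)
  con   : {N : SetSystem} → Minor M N → (S : Subset′ (Carrier N)) →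
          Indep N S → Minor M (contract N S)

record _≅_ (M N : SetSystem) : Set₁ where
  field
    bij   : Carrier M ↔ Carrier N
    indep : (I : Subset′ (Carrier M)) →
            Indep M I ⇔ Indep N (λ y → I (Inverse.from bij y))

-- The resonance arrangement A_n: hyperplanes H_I for ∅ ≠ I ⊆ [n],
-- with normal vector χ_I.

isEmpty : {n : ℕ} → Vec Bool n → Bool
isEmpty []       = true
isEmpty (b ∷ bs) = not b ∧ isEmpty bs

NonemptySubset : ℕ → Set
NonemptySubset n = Σ (Vec Bool n) (λ s → T (not (isEmpty s)))

χ : {n : ℕ} → NonemptySubset n → Fin n → ℚ
χ (s , _) i = if lookup s i then 1ℚ else 0ℚ

resonance : ℕ → SetSystem
resonance n = vecMatroid (χ {n})

-- Clearing denominators, each column v j becomes an integer vector a j − b j with a, b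
-- bounded by some K. In ℚ^dim, with coordinates u, t j (j < m) and r i, n i, z i k, y i k
-- (i < d, k < K), let Φ i x = x(r i) − x(n i) − Σₖ x(z i k) + Σₖ x(y i k). The 0/1 vectors
-- of {u}, {t j}, {r i, z i k}, {n i, y i k} and {r i, n i} form a basis of ker Φ: the forms
-- reading off u, t j, z i k, y i k and n i − Σₖ y i k are dual to them, and every vector
-- of ker Φ is recovered from these readings. The 0/1 vector of the column
-- {u, t j} ∪ {z i k | k < b j i} ∪ {y i k | k < a j i} is sent by Φ to a j − b j, so
-- contracting the basis in the resonance matroid and restricting to these columns yields
-- the matroid of the rescaled, hence of the original, configuration. The coordinates u and
-- t j keep the columns distinct from each other and from the basis vectors.

module Submission where

open import Defs

open import Data.Bool using (Bool; true; false; T; not; _∨_; if_then_else_)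
import Data.Bool.Properties as Bool
open import Data.Bool.Properties using (T-irrelevant; T-∨)
open import Data.Empty using (⊥; ⊥-elim)
open import Data.Fin using (Fin; zero; suc; toℕ)
import Data.Fin.Properties as Fin
open import Data.Fin.Properties using (+↔⊎; *↔×; 1↔⊤)
open import Data.Integer as ℤ using (ℤ; -[1+_]; ∣_∣)
import Data.Integer.Properties as ℤ
open import Data.Integer.Tactic.RingSolver using (solve-∀)
open import Data.List using (List; []; _∷_; foldr; map; _++_; filter; allFin)
open import Data.List.Properties using (map-tabulate)
open import Data.List.Membership.Propositional using (_∈_; _∉_)
open import Data.List.Membership.Propositional.Properties using (∈-map⁺; ∈-map⁻; ∈-allFin)
open import Data.List.Relation.Unary.All as All using (All; []; _∷_)
import Data.List.Relation.Unary.All.Properties as AllP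
open import Data.List.Relation.Unary.AllPairs using ([]; _∷_)
open import Data.List.Relation.Unary.Any using (here; there)
open import Data.List.Relation.Unary.Unique.Propositional using (Unique)
import Data.List.Relation.Unary.Unique.Propositional.Properties as Unique
open import Data.Nat as ℕ using (ℕ; suc; _≤_; _⊔_; _<ᵇ_)
import Data.Nat.Properties as ℕ
open import Data.Nat.Divisibility using (_∣_)
open import Data.Nat.ListAction using (product)
open import Data.Nat.ListAction.Properties using (∈⇒∣product; product≢0)
open import Data.Product using (Σ; _,_; proj₁; proj₂; ∃-syntax; Σ-syntax; _×_)
import Data.Product.Properties as Product
open import Data.Rational using (ℚ; 0ℚ; 1ℚ; _+_; _*_; -_; _-_; NonZero; 1/_; ↥_; ↧_; ↧ₙ_)
open import Data.Rational.Literals using (fromℤ)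
open import Data.Rational.Properties
  using (+-identityʳ; +-identityˡ; +-assoc; +-inverseʳ; *-identityʳ; *-identityˡ; *-zeroʳ; *-zeroˡ; *-assoc;
         *-distribˡ-+; *-inverseʳ; *-inverseˡ; neg-distrib-+; neg-distribˡ-*; neg-distribʳ-*; 1≢0;
         nonZero⇒1/nonZero; toℚᵘ-injective; toℚᵘ-homo-+; toℚᵘ-homo-*)
open import Data.Rational.Solver using (module +-*-Solver)
import Data.Rational.Unnormalised as ℚᵘ
import Data.Rational.Unnormalised.Properties as ℚᵘ
open import Data.Sum as Sum using (_⊎_; inj₁; inj₂; [_,_])
import Data.Sum.Properties as Sum
open import Data.Sum.Function.Propositional using (_⊎-↔_)
open import Data.Unit using (⊤; tt)
import Data.Unit.Properties as Unit
open import Data.Vec using (Vec; _∷_; lookup; tabulate)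
import Data.Vec.Properties as Vec
open import Function using (_∘_; id)
open import Function.Bundles using (_↔_; _⇔_; Inverse; Equivalence; mk⇔; mk↔ₛ′)
open import Function.Properties.Inverse using (↔-refl; ↔-trans)
open import Level using (0ℓ)
open import Relation.Binary.Definitions using (DecidableEquality)
open import Relation.Binary.PropositionalEquality
  using (_≡_; _≢_; refl; sym; trans; cong; cong₂; subst; ≢-sym; module ≡-Reasoning)
open import Relation.Nullary using (Dec; yes; no; ¬?; does)
open import Relation.Unary using (Pred; Decidable)

open +-*-Solver using (solve; _:+_; _:-_; _:=_; con)

∑ : {A : Set} → List A → (A → ℚ) → ℚ
∑ l g = foldr _+_ 0ℚ (map g l)

module _ {A : Set} where

  ∑-cong : (l : List A) {g h : A → ℚ} → (∀ {x} → x ∈ l → g x ≡ h x) → ∑ l g ≡ ∑ l h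
  ∑-cong []      g≡h = refl
  ∑-cong (x ∷ l) g≡h = cong₂ _+_ (g≡h (here refl)) (∑-cong l (g≡h ∘ there))

  ∑-congˡ : (l : List A) {g h : A → ℚ} → (∀ x → g x ≡ h x) → ∑ l g ≡ ∑ l h
  ∑-congˡ l g≡h = ∑-cong l (λ {x} _ → g≡h x)

  ∑-zero : (l : List A) {g : A → ℚ} → (∀ {x} → x ∈ l → g x ≡ 0ℚ) → ∑ l g ≡ 0ℚ
  ∑-zero l g≡0 = trans (∑-cong l g≡0) (∑-const0 l)
    where
    ∑-const0 : (l : List A) → ∑ l (λ _ → 0ℚ) ≡ 0ℚ
    ∑-const0 []      = refl
    ∑-const0 (_ ∷ l) = trans (+-identityˡ _) (∑-const0 l)

  ∑-++ : (xs ys : List A) (g : A → ℚ) → ∑ (xs ++ ys) g ≡ ∑ xs g + ∑ ys g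
  ∑-++ []       ys g = sym (+-identityˡ _)
  ∑-++ (x ∷ xs) ys g = trans (cong (g x +_) (∑-++ xs ys g)) (sym (+-assoc (g x) _ _))

  ∑-+ : (l : List A) (g h : A → ℚ) → ∑ l (λ x → g x + h x) ≡ ∑ l g + ∑ l h
  ∑-+ []      g h = refl
  ∑-+ (x ∷ l) g h = trans (cong (g x + h x +_) (∑-+ l g h))
    (solve 4 (λ a b c e → (a :+ b) :+ (c :+ e) := (a :+ c) :+ (b :+ e)) refl (g x) (h x) (∑ l g) (∑ l h))

  ∑-neg : (l : List A) (g : A → ℚ) → ∑ l (λ x → - g x) ≡ - ∑ l g
  ∑-neg []      g = refl
  ∑-neg (x ∷ l) g = trans (cong (- g x +_) (∑-neg l g)) (sym (neg-distrib-+ (g x) (∑ l g)))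

  ∑-*ˡ : (l : List A) (k : ℚ) (g : A → ℚ) → ∑ l (λ x → k * g x) ≡ k * ∑ l g
  ∑-*ˡ []      k g = sym (*-zeroʳ k)
  ∑-*ˡ (x ∷ l) k g = trans (cong (k * g x +_) (∑-*ˡ l k g)) (sym (*-distribˡ-+ k (g x) (∑ l g)))

  ∑-single : (l : List A) {g : A → ℚ} {e : A} → Unique l → e ∈ l →
             (∀ {x} → x ∈ l → x ≢ e → g x ≡ 0ℚ) → ∑ l g ≡ g e
  ∑-single (x ∷ l) {g} (x∉l ∷ _) (here refl) g≡0 =
    trans (cong (g x +_) (∑-zero l (λ y∈l → g≡0 (there y∈l) (≢-sym (All.lookup x∉l y∈l))))) (+-identityʳ (g x))
  ∑-single (x ∷ l) {g} (x∉l ∷ l-unique) (there e∈l) g≡0 =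
    trans (cong₂ _+_ (g≡0 (here refl) (All.lookup x∉l e∈l)) (∑-single l l-unique e∈l (g≡0 ∘ there)))
          (+-identityˡ _)

  ∑-filter : {P : Pred A 0ℓ} (P? : Decidable P) (l : List A) (g : A → ℚ) →
             ∑ l g ≡ ∑ (filter P? l) g + ∑ (filter (¬? ∘ P?) l) g
  ∑-filter P? []      g = refl
  ∑-filter P? (x ∷ l) g with does (P? x)
  ... | true  = trans (cong (g x +_) (∑-filter P? l g)) (sym (+-assoc (g x) _ _))
  ... | false = trans (cong (g x +_) (∑-filter P? l g))
    (solve 3 (λ a b c → a :+ (b :+ c) := b :+ (a :+ c)) refl (g x) (∑ (filter P? l) g) (∑ (filter (¬? ∘ P?) l) g))

module _ {A B : Set} where

  ∑-map : (l : List A) (h : A → B) (g : B → ℚ) → ∑ (map h l) g ≡ ∑ l (g ∘ h)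
  ∑-map []      h g = refl
  ∑-map (x ∷ l) h g = cong (g (h x) +_) (∑-map l h g)

  ∑-swap : (l : List A) (l′ : List B) (g : A → B → ℚ) →
           ∑ l (λ x → ∑ l′ (g x)) ≡ ∑ l′ (λ y → ∑ l (λ x → g x y))
  ∑-swap []      l′ g = sym (∑-zero l′ (λ _ → refl))
  ∑-swap (x ∷ l) l′ g = trans (cong (∑ l′ (g x) +_) (∑-swap l l′ g))
                              (sym (∑-+ l′ (g x) (λ y → ∑ l (λ x → g x y))))

∑-allFin-suc : ∀ k (g : Fin (suc k) → ℚ) → ∑ (allFin (suc k)) g ≡ g zero + ∑ (allFin k) (g ∘ suc)
∑-allFin-suc k g =
  cong (g zero +_) (cong (foldr _+_ 0ℚ) (trans (map-tabulate suc g) (sym (map-tabulate id (g ∘ suc)))))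

bit : Bool → ℚ
bit b = if b then 1ℚ else 0ℚ

bit-injective : ∀ {x y} → bit x ≡ bit y → x ≡ y
bit-injective {false} {false} _ = refl
bit-injective {false} {true}  0≡1 = ⊥-elim (1≢0 (sym 0≡1))
bit-injective {true}  {false} 1≡0 = ⊥-elim (1≢0 1≡0)
bit-injective {true}  {true}  _ = refl

module Indicator {A : Set} (_≟_ : DecidableEquality A) where

  open import Data.List.Membership.DecPropositional _≟_ using (_∈?_)

  δ : A → A → ℚ
  δ x y = bit (does (x ≟ y))

  δ-refl : ∀ x → δ x x ≡ 1ℚ
  δ-refl x with x ≟ x
  ... | yes _   = refl
  ... | no x≢x = ⊥-elim (x≢x refl)

  δ-≢ : ∀ {x y} → x ≢ y → δ x y ≡ 0ℚ
  δ-≢ {x} {y} x≢y with x ≟ y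
  ... | yes x≡y = ⊥-elim (x≢y x≡y)
  ... | no _    = refl

  bit-∈ : ∀ {x} (L : List A) → Unique L → bit (does (x ∈? L)) ≡ ∑ L (δ x)
  bit-∈     []      _                  = refl
  bit-∈ {x} (y ∷ L) (y∉L ∷ L-unique) with x ≟ y
  ... | yes refl = sym (trans (cong (1ℚ +_) (∑-zero L (λ z∈L → δ-≢ (All.lookup y∉L z∈L)))) (+-identityʳ 1ℚ))
  ... | no _     = trans (bit-∈ L L-unique) (sym (+-identityˡ _))

  ∑-*δ : (l : List A) (g : A → ℚ) {y : A} → Unique l → y ∈ l → ∑ l (λ x → g x * δ x y) ≡ g y
  ∑-*δ l g {y} l-unique y∈l =
    trans (∑-single l l-unique y∈l (λ {x} _ x≢y → trans (cong (g x *_) (δ-≢ x≢y)) (*-zeroʳ (g x))))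
          (trans (cong (g y *_) (δ-refl y)) (*-identityʳ (g y)))

  ∑-*bit-∈ : (l L : List A) (g : A → ℚ) → Unique l → Unique L → (∀ {y} → y ∈ L → y ∈ l) →
             ∑ l (λ x → g x * bit (does (x ∈? L))) ≡ ∑ L g
  ∑-*bit-∈ l L g l-unique L-unique L⊆l = begin
    ∑ l (λ x → g x * bit (does (x ∈? L)))
      ≡⟨ ∑-congˡ l (λ x → cong (g x *_) (bit-∈ L L-unique)) ⟩
    ∑ l (λ x → g x * ∑ L (δ x))
      ≡⟨ ∑-congˡ l (λ x → sym (∑-*ˡ L (g x) (δ x))) ⟩
    ∑ l (λ x → ∑ L (λ y → g x * δ x y))
      ≡⟨ ∑-swap l L (λ x y → g x * δ x y) ⟩
    ∑ L (λ y → ∑ l (λ x → g x * δ x y))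
      ≡⟨ ∑-cong L (λ y∈L → ∑-*δ l g l-unique (L⊆l y∈L)) ⟩
    ∑ L g ∎
    where open ≡-Reasoning

fromℤ-homo-+ : ∀ i j → fromℤ (i ℤ.+ j) ≡ fromℤ i + fromℤ j
fromℤ-homo-+ i j =
  toℚᵘ-injective (ℚᵘ.≃-sym (ℚᵘ.≃-trans (toℚᵘ-homo-+ (fromℤ i) (fromℤ j)) (ℚᵘ.*≡* (ring i j))))
  where
  ring : ∀ i j → (i ℤ.* ℤ.+ 1 ℤ.+ j ℤ.* ℤ.+ 1) ℤ.* ℤ.+ 1 ≡ (i ℤ.+ j) ℤ.* (ℤ.+ 1 ℤ.* ℤ.+ 1)
  ring = solve-∀

fromℤ-homo-* : ∀ i j → fromℤ (i ℤ.* j) ≡ fromℤ i * fromℤ j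
fromℤ-homo-* i j =
  toℚᵘ-injective (ℚᵘ.≃-sym (ℚᵘ.≃-trans (toℚᵘ-homo-* (fromℤ i) (fromℤ j)) (ℚᵘ.*≡* (ring i j))))
  where
  ring : ∀ i j → (i ℤ.* j) ℤ.* ℤ.+ 1 ≡ (i ℤ.* j) ℤ.* (ℤ.+ 1 ℤ.* ℤ.+ 1)
  ring = solve-∀

↧*p≡↥ : ∀ p → fromℤ (↧ p) * p ≡ fromℤ (↥ p)
↧*p≡↥ p@record{} =
  toℚᵘ-injective (ℚᵘ.≃-trans (toℚᵘ-homo-* (fromℤ (↧ p)) p) (ℚᵘ.*≡* (ring (↥ p) (↧ p))))
  where
  ring : ∀ n D → (D ℤ.* n) ℤ.* ℤ.+ 1 ≡ n ℤ.* (ℤ.+ 1 ℤ.* D)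
  ring = solve-∀

x*y≡0⇒x≡0 : ∀ x y .{{_ : NonZero y}} → x * y ≡ 0ℚ → x ≡ 0ℚ
x*y≡0⇒x≡0 x y x*y≡0 = begin
  x              ≡⟨ sym (*-identityʳ x) ⟩
  x * 1ℚ         ≡⟨ cong (x *_) (sym (*-inverseʳ y)) ⟩
  x * (y * 1/ y) ≡⟨ sym (*-assoc x y (1/ y)) ⟩
  x * y * 1/ y   ≡⟨ cong (_* 1/ y) x*y≡0 ⟩
  0ℚ * 1/ y      ≡⟨ *-zeroˡ (1/ y) ⟩
  0ℚ             ∎
  where open ≡-Reasoning

∑-bits-below : ∀ K a → a ≤ K → ∑ (allFin K) (λ k → bit (toℕ k <ᵇ a)) ≡ fromℤ (ℤ.+ a)
∑-bits-below ℕ.zero    ℕ.zero    ℕ.z≤n       = refl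
∑-bits-below (ℕ.suc K) ℕ.zero    _           =
  trans (∑-allFin-suc K (λ k → bit (toℕ k <ᵇ 0))) (trans (+-identityˡ _) (∑-zero (allFin K) (λ _ → refl)))
∑-bits-below (ℕ.suc K) (ℕ.suc a) (ℕ.s≤s a≤K) =
  trans (∑-allFin-suc K (λ k → bit (toℕ k <ᵇ ℕ.suc a)))
        (trans (cong (1ℚ +_) (∑-bits-below K a a≤K)) (sym (fromℤ-homo-+ (ℤ.+ 1) (ℤ.+ a))))

record CommonDenominator {d : ℕ} (u : Fin d → ℚ) : Set where
  field
    denominator          : ℕ
    {{denominator≢0}}    : ℕ.NonZero denominator
    numerator            : Fin d → ℤ
    denominator*u≡numerator : ∀ i → fromℤ (ℤ.+ denominator) * u i ≡ fromℤ (numerator i)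

commonDenominator : ∀ {d} (u : Fin d → ℚ) → CommonDenominator u
commonDenominator {d} u = record
  { denominator             = D
  ; denominator≢0           = product≢0 (AllP.map⁺ (All.universal (λ _ → _) (allFin d)))
  ; numerator               = λ i → ℤ.+ cofactor i ℤ.* ↥ u i
  ; denominator*u≡numerator = clears
  }
  where
  D : ℕ
  D = product (map (λ i → ↧ₙ u i) (allFin d))

  ↧∣D : ∀ i → ↧ₙ u i ∣ D
  ↧∣D i = ∈⇒∣product (∈-map⁺ (λ i → ↧ₙ u i) (∈-allFin i))

  cofactor : Fin d → ℕ
  cofactor i = _∣_.quotient (↧∣D i)

  D≡cofactor*↧ : ∀ i → D ≡ cofactor i ℕ.* ↧ₙ u i
  D≡cofactor*↧ i = _∣_.equality (↧∣D i)

  clears : ∀ i → fromℤ (ℤ.+ D) * u i ≡ fromℤ (ℤ.+ cofactor i ℤ.* ↥ u i)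
  clears i = begin
    fromℤ (ℤ.+ D) * u i
      ≡⟨ cong (λ k → fromℤ (ℤ.+ k) * u i) (D≡cofactor*↧ i) ⟩
    fromℤ (ℤ.+ (cofactor i ℕ.* ↧ₙ u i)) * u i
      ≡⟨ cong (λ z → fromℤ z * u i) (ℤ.pos-* (cofactor i) (↧ₙ u i)) ⟩
    fromℤ (ℤ.+ cofactor i ℤ.* ↧ u i) * u i
      ≡⟨ cong (_* u i) (fromℤ-homo-* (ℤ.+ cofactor i) (↧ u i)) ⟩
    fromℤ (ℤ.+ cofactor i) * fromℤ (↧ u i) * u i
      ≡⟨ *-assoc (fromℤ (ℤ.+ cofactor i)) (fromℤ (↧ u i)) (u i) ⟩
    fromℤ (ℤ.+ cofactor i) * (fromℤ (↧ u i) * u i)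
      ≡⟨ cong (fromℤ (ℤ.+ cofactor i) *_) (↧*p≡↥ (u i)) ⟩
    fromℤ (ℤ.+ cofactor i) * fromℤ (↥ u i)
      ≡⟨ sym (fromℤ-homo-* (ℤ.+ cofactor i) (↥ u i)) ⟩
    fromℤ (ℤ.+ cofactor i ℤ.* ↥ u i) ∎
    where open ≡-Reasoning

positivePart negativePart : ℤ → ℕ
positivePart (ℤ.+ k)  = k
positivePart -[1+ k ] = 0
negativePart (ℤ.+ k)  = 0
negativePart -[1+ k ] = ℕ.suc k

fromℤ≡parts : ∀ z → fromℤ z ≡ fromℤ (ℤ.+ positivePart z) - fromℤ (ℤ.+ negativePart z)
fromℤ≡parts (ℤ.+ k)  = sym (+-identityʳ (fromℤ (ℤ.+ k)))
fromℤ≡parts -[1+ k ] = sym (+-identityˡ (fromℤ -[1+ k ]))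

positivePart≤∣∣ : ∀ z → positivePart z ≤ ∣ z ∣
positivePart≤∣∣ (ℤ.+ k)  = ℕ.≤-refl
positivePart≤∣∣ -[1+ k ] = ℕ.z≤n

negativePart≤∣∣ : ∀ z → negativePart z ≤ ∣ z ∣
negativePart≤∣∣ (ℤ.+ k)  = ℕ.z≤n
negativePart≤∣∣ -[1+ k ] = ℕ.≤-refl

bounded : ∀ {m} (g : Fin m → ℕ) → ∃[ K ] (∀ j → g j ≤ K)
bounded {ℕ.zero}  g = 0 , λ ()
bounded {ℕ.suc m} g with bounded (g ∘ suc)
... | K , g∘suc≤K = g zero ⊔ K , λ
  { zero    → ℕ.m≤m⊔n (g zero) K
  ; (suc j) → ℕ.≤-trans (g∘suc≤K j) (ℕ.m≤n⊔m (g zero) K)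
  }

bounded₂ : ∀ {m d} (g : Fin m → Fin d → ℕ) → ∃[ K ] (∀ j i → g j i ≤ K)
bounded₂ g with bounded (λ j → proj₁ (bounded (g j)))
... | K , row≤K = K , λ j i → ℕ.≤-trans (proj₂ (bounded (g j)) i) (row≤K j)

T-does⁻ : {P : Set} (p? : Dec P) → T (does p?) → P
T-does⁻ (yes p) _ = p

T-does⁺ : {P : Set} (p? : Dec P) → P → T (does p?)
T-does⁺ (yes _)  _ = _
T-does⁺ (no ¬p) p = ¬p p

map-preimage : {A B : Set} (f : A → B) {P : A → Set} (ys : List B) →
               All (λ y → ∃[ x ] f x ≡ y × P x) ys → ∃[ xs ] map f xs ≡ ys × All P xs
map-preimage f []       []                    = [] , refl , []
map-preimage f (_ ∷ ys) ((x , refl , px) ∷ h) with map-preimage f ys h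
... | xs , refl , pxs = x ∷ xs , refl , px ∷ pxs

module _ {A E : Set} (_≟_ : DecidableEquality E) (h : A → E)
         (h-injective : ∀ {a a′} → h a ≡ h a′ → a ≡ a′) (as : List A) where

  open import Data.List.Membership.DecPropositional _≟_ using (_∈?_)

  extendAlong : (A → ℚ) → E → ℚ
  extendAlong g e with e ∈? map h as
  ... | yes e∈ = g (proj₁ (∈-map⁻ h e∈))
  ... | no _   = 0ℚ

  extendAlong-apply : ∀ g {a} → a ∈ as → extendAlong g (h a) ≡ g a
  extendAlong-apply g {a} a∈as with h a ∈? map h as
  ... | yes ha∈ = cong g (sym (h-injective (proj₂ (proj₂ (∈-map⁻ h ha∈)))))
  ... | no ha∉  = ⊥-elim (ha∉ (∈-map⁺ h a∈as))

module Enumeration {k : ℕ} {A : Set} (Fin↔A : Fin k ↔ A) where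

  open Inverse Fin↔A

  enumeration : List A
  enumeration = map to (allFin k)

  enumeration-unique : Unique enumeration
  enumeration-unique = Unique.map⁺ to-injective (Unique.allFin⁺ k)
    where
    to-injective : ∀ {x y} → to x ≡ to y → x ≡ y
    to-injective {x} {y} tx≡ty = trans (sym (strictlyInverseʳ x)) (trans (cong from tx≡ty) (strictlyInverseʳ y))

  ∈-enumeration : ∀ a → a ∈ enumeration
  ∈-enumeration a = subst (_∈ enumeration) (strictlyInverseˡ a) (∈-map⁺ to (∈-allFin (from a)))

-- Linear forms and dual bases

module _ {n : ℕ} where

  -- A record rather than a Π-type, so that φ can be inferred from Linear φ.
  record Linear (φ : (Fin n → ℚ) → ℚ) : Set₁ where
    constructor linear
    field
      distrib-lincomb : ∀ {A : Set} (u : A → Fin n → ℚ) (c : A → ℚ) (l : List A) →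
                        φ (lincomb u c l) ≡ ∑ l (λ a → c a * φ (u a))

  open Linear public

  Congruent : ((Fin n → ℚ) → ℚ) → Set
  Congruent φ = ∀ {x y} → (∀ q → x q ≡ y q) → φ x ≡ φ y

  linear-congruent-zero : ∀ {φ x} → Linear φ → Congruent φ → (∀ q → x q ≡ 0ℚ) → φ x ≡ 0ℚ
  linear-congruent-zero φ-linear φ-cong x≗0 =
    trans (φ-cong x≗0) (distrib-lincomb φ-linear {⊤} (λ _ _ → 0ℚ) (λ _ → 0ℚ) [])

  projection-linear : ∀ q → Linear (λ x → x q)
  projection-linear q = linear (λ u c l → refl)

  +-linear : ∀ {φ ψ} → Linear φ → Linear ψ → Linear (λ x → φ x + ψ x)
  +-linear {φ} {ψ} φ-linear ψ-linear = linear λ u c l →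
    trans (cong₂ _+_ (distrib-lincomb φ-linear u c l) (distrib-lincomb ψ-linear u c l))
          (trans (sym (∑-+ l _ _)) (∑-congˡ l (λ a → sym (*-distribˡ-+ (c a) (φ (u a)) (ψ (u a))))))

  neg-linear : ∀ {φ} → Linear φ → Linear (λ x → - φ x)
  neg-linear {φ} φ-linear = linear λ u c l →
    trans (cong -_ (distrib-lincomb φ-linear u c l))
          (trans (sym (∑-neg l _)) (∑-congˡ l (λ a → neg-distribʳ-* (c a) (φ (u a)))))

  ∑-linear : {B : Set} (ks : List B) {φ : B → (Fin n → ℚ) → ℚ} → (∀ k → Linear (φ k)) →
             Linear (λ x → ∑ ks (λ k → φ k x))
  ∑-linear ks {φ} φ-linear = linear λ u c l → let open ≡-Reasoning in begin
    ∑ ks (λ k → φ k (lincomb u c l))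
      ≡⟨ ∑-congˡ ks (λ k → distrib-lincomb (φ-linear k) u c l) ⟩
    ∑ ks (λ k → ∑ l (λ a → c a * φ k (u a)))
      ≡⟨ ∑-swap ks l _ ⟩
    ∑ l (λ a → ∑ ks (λ k → c a * φ k (u a)))
      ≡⟨ ∑-congˡ l (λ a → ∑-*ˡ ks (c a) _) ⟩
    ∑ l (λ a → c a * ∑ ks (λ k → φ k (u a))) ∎

module Biorthogonal {B E : Set} {n : ℕ} (_≟_ : DecidableEquality B) (w : E → Fin n → ℚ) (b : B → E)
  (ψ : B → (Fin n → ℚ) → ℚ) (ψ-linear : ∀ β → Linear (ψ β)) (ψ-cong : ∀ β → Congruent (ψ β))
  (ψ-dual : ∀ β β′ → ψ β (w (b β′)) ≡ Indicator.δ _≟_ β′ β)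
  where

  open Indicator _≟_ using (δ; δ-refl; δ-≢)

  b-injective : ∀ {β β′} → b β ≡ b β′ → β ≡ β′
  b-injective {β} {β′} bβ≡bβ′ with β′ ≟ β
  ... | yes β′≡β = sym β′≡β
  ... | no β′≢β = ⊥-elim (1≢0 (begin
    1ℚ              ≡⟨ sym (δ-refl β) ⟩
    δ β β           ≡⟨ sym (ψ-dual β β) ⟩
    ψ β (w (b β))   ≡⟨ cong (ψ β ∘ w) bβ≡bβ′ ⟩
    ψ β (w (b β′))  ≡⟨ ψ-dual β β′ ⟩
    δ β′ β          ≡⟨ δ-≢ β′≢β ⟩
    0ℚ              ∎))
    where open ≡-Reasoning

  image-independent : (S : Subset′ E) → (∀ {e} → T (S e) → ∃[ β ] b β ≡ e) → LinIndep w S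
  image-independent S S⊆image l l-unique l⊆S c lincomb≡0 = All.tabulate coefficient-zero
    where
    preimage : ∀ {e} → e ∈ l → ∃[ β ] b β ≡ e
    preimage e∈l = S⊆image (All.lookup l⊆S e∈l)

    coefficient-zero : ∀ {e} → e ∈ l → c e ≡ 0ℚ
    coefficient-zero {e} e∈l with preimage e∈l
    ... | β , refl = begin
      c (b β)
        ≡⟨ sym (*-identityʳ _) ⟩
      c (b β) * 1ℚ
        ≡⟨ cong (c (b β) *_) (sym (trans (ψ-dual β β) (δ-refl β))) ⟩
      c (b β) * ψ β (w (b β))
        ≡⟨ sym (∑-single l l-unique e∈l other-terms-vanish) ⟩
      ∑ l (λ e′ → c e′ * ψ β (w e′))
        ≡⟨ sym (distrib-lincomb (ψ-linear β) w c l) ⟩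
      ψ β (lincomb w c l)
        ≡⟨ linear-congruent-zero (ψ-linear β) (ψ-cong β) lincomb≡0 ⟩
      0ℚ ∎
      where
      open ≡-Reasoning
      other-terms-vanish : ∀ {e′} → e′ ∈ l → e′ ≢ b β → c e′ * ψ β (w e′) ≡ 0ℚ
      other-terms-vanish e′∈l e′≢bβ with preimage e′∈l
      ... | β′ , refl = trans (cong (c (b β′) *_) (trans (ψ-dual β β′) (δ-≢ (e′≢bβ ∘ cong b))))
                              (*-zeroʳ (c (b β′)))

Σ-T-≡ : {A : Set} {P : A → Bool} {a a′ : A} {p : T (P a)} {p′ : T (P a′)} →
        a ≡ a′ → _≡_ {A = Σ A (T ∘ P)} (a , p) (a′ , p′)
Σ-T-≡ {p = p} {p′} refl = cong (_ ,_) (T-irrelevant p p′)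

ext-elim : ∀ b (g : T b → Bool) → T (ext b g) → Σ[ t ∈ T b ] T (g t)
ext-elim true g h = _ , h

ext-intro : ∀ b (g : T b → Bool) (t : T b) → T (g t) → T (ext b g)
ext-intro true g _ h = h

module ContractRestrict (M : SetSystem) (_≟_ : DecidableEquality (Carrier M)) (S : Subset′ (Carrier M))
  {m : ℕ} (f : Fin m → Carrier M) (f-injective : ∀ {j j′} → f j ≡ f j′ → j ≡ j′)
  (f∉S : ∀ j → T (not (S (f j))))
  where

  image : Subset′ (Carrier (contract M S))
  image (e , _) = does (Fin.any? (λ j → f j ≟ e))

  N : SetSystem
  N = restrict (contract M S) image

  private
    preimage : ∀ {e} → T (does (Fin.any? (λ j → f j ≟ e))) → ∃[ j ] f j ≡ e
    preimage = T-does⁻ (Fin.any? _)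

  toN : Fin m → Carrier N
  toN j = (f j , f∉S j) , T-does⁺ (Fin.any? _) (j , refl)

  fromN : Carrier N → Fin m
  fromN (_ , e∈image) = proj₁ (preimage e∈image)

  f∘fromN : ∀ y → f (fromN y) ≡ proj₁ (proj₁ y)
  f∘fromN (_ , e∈image) = proj₂ (preimage e∈image)

  fromN-f : ∀ {j} (t : T (not (S (f j)))) (t′ : T (image (f j , t))) → fromN ((f j , t) , t′) ≡ j
  fromN-f t t′ = f-injective (f∘fromN ((_ , t) , t′))

  Fin↔N : Fin m ↔ Carrier N
  Fin↔N = mk↔ₛ′ toN fromN (λ y → Σ-T-≡ (Σ-T-≡ (f∘fromN y))) (λ j → fromN-f (f∉S j) _)

  -- Indep N (I ∘ fromN) unfolds definitionally to Indep M (Contracted I).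
  Contracted : (Fin m → Bool) → Subset′ (Carrier M)
  Contracted I e = S e ∨ ext (not (S e)) (λ t → ext (image (e , t)) (λ t′ → I (fromN ((e , t) , t′))))

  Contracted-members : ∀ I e → T (Contracted I e) ⇔ (T (S e) ⊎ ∃[ j ] f j ≡ e × T (I j))
  Contracted-members I e = mk⇔ to from
    where
    to : T (Contracted I e) → T (S e) ⊎ ∃[ j ] f j ≡ e × T (I j)
    to h with Equivalence.to T-∨ h
    ... | inj₁ e∈S = inj₁ e∈S
    ... | inj₂ h′ with ext-elim (not (S e)) _ h′
    ... | t , h″ with ext-elim (image (e , t)) _ h″
    ... | t′ , Ij = inj₂ (fromN ((e , t) , t′) , f∘fromN ((e , t) , t′) , Ij)

    from : T (S e) ⊎ ∃[ j ] f j ≡ e × T (I j) → T (Contracted I e)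
    from (inj₁ e∈S) = Equivalence.from T-∨ (inj₁ e∈S)
    from (inj₂ (j , refl , Ij)) = Equivalence.from (T-∨ {S (f j)}) (inj₂
      (ext-intro (not (S (f j))) _ (f∉S j) (ext-intro (image (f j , f∉S j)) _ (proj₂ (toN j))
        (subst (T ∘ I) (sym (fromN-f (f∉S j) (proj₂ (toN j)))) Ij))))

-- Realising a configuration as a minor

module Transfer {E : Set} (_≟_ : DecidableEquality E) where

  open import Data.List.Membership.DecPropositional _≟_ using (_∈?_)

  module _
    {n d m : ℕ} (w : E → Fin n → ℚ) (v : Fin m → Fin d → ℚ)
    (Φ : Fin d → (Fin n → ℚ) → ℚ) (Φ-linear : ∀ i → Linear (Φ i)) (Φ-cong : ∀ i → Congruent (Φ i))
    (basis : List E) (basis-unique : Unique basis)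
    (basis-independent : LinIndep w (λ e → does (e ∈? basis)))
    (Φ-basis : ∀ {e} → e ∈ basis → ∀ i → Φ i (w e) ≡ 0ℚ)
    (kernel-spanned : ∀ x → (∀ i → Φ i x ≡ 0ℚ) → Σ[ α ∈ (E → ℚ) ] ∀ q → x q ≡ lincomb w α basis q)
    (f : Fin m → E) (f-injective : ∀ {j j′} → f j ≡ f j′ → j ≡ j′) (f∉basis : ∀ j → f j ∉ basis)
    (scale : Fin m → ℚ) (scale≢0 : ∀ j → NonZero (scale j))
    (Φ∘f : ∀ j i → Φ i (w (f j)) ≡ scale j * v j i)
    where

    IsBasis∪Image : (Fin m → Bool) → Subset′ E → Set
    IsBasis∪Image I J = ∀ e → T (J e) ⇔ (e ∈ basis ⊎ ∃[ j ] f j ≡ e × T (I j))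

    private
      instance
        scale-nonZero : ∀ {j} → NonZero (scale j)
        scale-nonZero {j} = scale≢0 j

    indep-v⇒indep-w : ∀ {I J} → IsBasis∪Image I J → LinIndep v I → LinIndep w J
    indep-v⇒indep-w {I} {J} J≐ v-independent l l-unique l⊆J c lincomb≡0 =
      AllP.filter⁻ (_∈? basis) on-zero off-zero
      where
      on off : List E
      on  = filter (_∈? basis) l
      off = filter (¬? ∘ (_∈? basis)) l

      off-columns : All (λ e → ∃[ j ] f j ≡ e × T (I j)) off
      off-columns = All.zipWith column (AllP.all-filter (¬? ∘ (_∈? basis)) l , AllP.filter⁺ (¬? ∘ (_∈? basis)) l⊆J)
        where
        column : ∀ {e} → e ∉ basis × T (J e) → ∃[ j ] f j ≡ e × T (I j)
        column (e∉ , e∈J) = [ ⊥-elim ∘ e∉ , id ] (Equivalence.to (J≐ _) e∈J)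

      l′ : List (Fin m)
      l′ = proj₁ (map-preimage f off off-columns)
      map-f-l′ : map f l′ ≡ off
      map-f-l′ = proj₁ (proj₂ (map-preimage f off off-columns))

      Φ-off : ∀ i → ∑ off (λ e → c e * Φ i (w e)) ≡ 0ℚ
      Φ-off i = begin
        ∑ off (λ e → c e * Φ i (w e))
          ≡⟨ sym (+-identityˡ _) ⟩
        0ℚ + ∑ off (λ e → c e * Φ i (w e))
          ≡⟨ cong (_+ ∑ off (λ e → c e * Φ i (w e))) (sym on-vanishes) ⟩
        ∑ on (λ e → c e * Φ i (w e)) + ∑ off (λ e → c e * Φ i (w e))
          ≡⟨ sym (∑-filter (_∈? basis) l _) ⟩
        ∑ l (λ e → c e * Φ i (w e))
          ≡⟨ sym (distrib-lincomb (Φ-linear i) w c l) ⟩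
        Φ i (lincomb w c l)
          ≡⟨ linear-congruent-zero (Φ-linear i) (Φ-cong i) lincomb≡0 ⟩
        0ℚ ∎
        where
        open ≡-Reasoning
        on-vanishes : ∑ on (λ e → c e * Φ i (w e)) ≡ 0ℚ
        on-vanishes = ∑-zero on (λ {e} e∈on →
          trans (cong (c e *_) (Φ-basis (All.lookup (AllP.all-filter (_∈? basis) l) e∈on) i)) (*-zeroʳ (c e)))

      scaled-dependency : ∀ i → lincomb v (λ j → c (f j) * scale j) l′ i ≡ 0ℚ
      scaled-dependency i = begin
        ∑ l′ (λ j → c (f j) * scale j * v j i)
          ≡⟨ ∑-congˡ l′ (λ j → trans (*-assoc (c (f j)) (scale j) (v j i))
                                     (cong (c (f j) *_) (sym (Φ∘f j i)))) ⟩
        ∑ l′ (λ j → c (f j) * Φ i (w (f j)))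
          ≡⟨ sym (∑-map l′ f _) ⟩
        ∑ (map f l′) (λ e → c e * Φ i (w e))
          ≡⟨ cong (λ L → ∑ L (λ e → c e * Φ i (w e))) map-f-l′ ⟩
        ∑ off (λ e → c e * Φ i (w e))
          ≡⟨ Φ-off i ⟩
        0ℚ ∎
        where open ≡-Reasoning

      off-zero : All (λ e → c e ≡ 0ℚ) off
      off-zero = subst (All (λ e → c e ≡ 0ℚ)) map-f-l′
                       (AllP.map⁺ (All.map (λ {j} → x*y≡0⇒x≡0 (c (f j)) (scale j)) scaled-zero))
        where
        l′-unique : Unique l′
        l′-unique = Unique.map⁻ (subst Unique (sym map-f-l′) (Unique.filter⁺ (¬? ∘ (_∈? basis)) l-unique))

        scaled-zero : All (λ j → c (f j) * scale j ≡ 0ℚ) l′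
        scaled-zero = v-independent l′ l′-unique (proj₂ (proj₂ (map-preimage f off off-columns)))
                                    (λ j → c (f j) * scale j) scaled-dependency

      on-zero : All (λ e → c e ≡ 0ℚ) on
      on-zero = basis-independent on (Unique.filter⁺ (_∈? basis) l-unique)
        (All.map (T-does⁺ (_ ∈? basis)) (AllP.all-filter (_∈? basis) l)) c on-dependency
        where
        on-dependency : ∀ q → lincomb w c on q ≡ 0ℚ
        on-dependency q = begin
          ∑ on (λ e → c e * w e q)
            ≡⟨ sym (+-identityʳ _) ⟩
          ∑ on (λ e → c e * w e q) + 0ℚ
            ≡⟨ cong (∑ on (λ e → c e * w e q) +_) (sym (∑-zero off (λ {e} e∈off →
                 trans (cong (_* w e q) (All.lookup off-zero e∈off)) (*-zeroˡ (w e q))))) ⟩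
          ∑ on (λ e → c e * w e q) + ∑ off (λ e → c e * w e q)
            ≡⟨ sym (∑-filter (_∈? basis) l _) ⟩
          lincomb w c l q
            ≡⟨ lincomb≡0 q ⟩
          0ℚ ∎
          where open ≡-Reasoning

    indep-w⇒indep-v : ∀ {I J} → IsBasis∪Image I J → LinIndep w J → LinIndep v I
    indep-w⇒indep-v {I} {J} J≐ w-independent l′ l′-unique l′⊆I c′ lincomb≡0 =
      All.map (λ {j} → x*y≡0⇒x≡0 (c′ j) (1/ scale j) {{nonZero⇒1/nonZero (scale j)}}) cc-zero
      where
      cc : Fin m → ℚ
      cc j = c′ j * 1/ scale j

      x : Fin n → ℚ
      x = lincomb (w ∘ f) cc l′

      Φx≡0 : ∀ i → Φ i x ≡ 0ℚ
      Φx≡0 i = begin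
        Φ i x                                   ≡⟨ distrib-lincomb (Φ-linear i) (w ∘ f) cc l′ ⟩
        ∑ l′ (λ j → cc j * Φ i (w (f j)))       ≡⟨ ∑-congˡ l′ (λ j → cong (cc j *_) (Φ∘f j i)) ⟩
        ∑ l′ (λ j → cc j * (scale j * v j i))   ≡⟨ ∑-congˡ l′ unscale ⟩
        ∑ l′ (λ j → c′ j * v j i)               ≡⟨ lincomb≡0 i ⟩
        0ℚ                                      ∎
        where
        open ≡-Reasoning
        unscale : ∀ j → cc j * (scale j * v j i) ≡ c′ j * v j i
        unscale j = begin
          c′ j * 1/ scale j * (scale j * v j i)
            ≡⟨ *-assoc (c′ j) _ _ ⟩
          c′ j * (1/ scale j * (scale j * v j i))
            ≡⟨ cong (c′ j *_) (sym (*-assoc (1/ scale j) _ _)) ⟩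
          c′ j * (1/ scale j * scale j * v j i)
            ≡⟨ cong (λ y → c′ j * (y * v j i)) (*-inverseˡ (scale j)) ⟩
          c′ j * (1ℚ * v j i)
            ≡⟨ cong (c′ j *_) (*-identityˡ (v j i)) ⟩
          c′ j * v j i ∎

      α : E → ℚ
      α = proj₁ (kernel-spanned x Φx≡0)

      coef : E → ℚ
      coef e with e ∈? basis
      ... | yes _ = - α e
      ... | no _  = extendAlong _≟_ f f-injective (allFin m) cc e

      coef-f : ∀ j → coef (f j) ≡ cc j
      coef-f j with f j ∈? basis
      ... | yes fj∈ = ⊥-elim (f∉basis j fj∈)
      ... | no _    = extendAlong-apply _≟_ f f-injective (allFin m) cc (∈-allFin j)

      coef-basis : ∀ {e} → e ∈ basis → coef e ≡ - α e
      coef-basis {e} e∈ with e ∈? basis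
      ... | yes _  = refl
      ... | no e∉ = ⊥-elim (e∉ e∈)

      L : List E
      L = map f l′ ++ basis

      L-unique : Unique L
      L-unique = Unique.++⁺ (Unique.map⁺ f-injective l′-unique) basis-unique disjoint
        where
        disjoint : ∀ {e} → e ∈ map f l′ × e ∈ basis → ⊥
        disjoint (e∈ , e∈basis) with ∈-map⁻ f e∈
        ... | j , _ , refl = f∉basis j e∈basis

      L⊆J : All (T ∘ J) L
      L⊆J = AllP.++⁺ (AllP.map⁺ (All.map (λ {j} Ij → Equivalence.from (J≐ (f j)) (inj₂ (j , refl , Ij))) l′⊆I))
                     (All.tabulate (λ {e} e∈ → Equivalence.from (J≐ e) (inj₁ e∈)))

      dependency : ∀ q → lincomb w coef L q ≡ 0ℚ
      dependency q = begin
        ∑ (map f l′ ++ basis) (λ e → coef e * w e q)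
          ≡⟨ ∑-++ (map f l′) basis _ ⟩
        ∑ (map f l′) (λ e → coef e * w e q) + ∑ basis (λ e → coef e * w e q)
          ≡⟨ cong₂ _+_ columns basis-part ⟩
        x q - lincomb w α basis q
          ≡⟨ cong (_- lincomb w α basis q) (proj₂ (kernel-spanned x Φx≡0) q) ⟩
        lincomb w α basis q - lincomb w α basis q
          ≡⟨ +-inverseʳ (lincomb w α basis q) ⟩
        0ℚ ∎
        where
        open ≡-Reasoning
        columns : ∑ (map f l′) (λ e → coef e * w e q) ≡ x q
        columns = trans (∑-map l′ f _) (∑-congˡ l′ (λ j → cong (_* w (f j) q) (coef-f j)))
        basis-part : ∑ basis (λ e → coef e * w e q) ≡ - lincomb w α basis q
        basis-part = trans (∑-cong basis (λ {e} e∈ → trans (cong (_* w e q) (coef-basis e∈))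
                                                         (sym (neg-distribˡ-* (α e) (w e q)))))
                           (∑-neg basis (λ e → α e * w e q))

      cc-zero : All (λ j → cc j ≡ 0ℚ) l′
      cc-zero = All.map (λ {j} → trans (sym (coef-f j)))
                        (AllP.map⁻ (AllP.++⁻ˡ (map f l′) (w-independent L L-unique L⊆J coef dependency)))

    realisedAsMinor : Σ[ N ∈ SetSystem ] (Minor (vecMatroid w) N × (repMatroid d m v ≅ N))
    realisedAsMinor = N , res (con here _ basis-independent) image , record
      { bij   = Fin↔N
      ; indep = λ I → mk⇔ (indep-v⇒indep-w (members I)) (indep-w⇒indep-v (members I))
      }
      where
      open ContractRestrict (vecMatroid w) _≟_ (λ e → does (e ∈? basis)) f f-injective
                            (λ j → T-does⁺ (¬? (f j ∈? basis)) (f∉basis j))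
      members : ∀ I → IsBasis∪Image I (Contracted I)
      members I e = mk⇔ (Sum.map₁ (T-does⁻ (e ∈? basis)) ∘ Equivalence.to (Contracted-members I e))
                        (Equivalence.from (Contracted-members I e) ∘ Sum.map₁ (T-does⁺ (e ∈? basis)))

-- The gadget

lookup⇒nonempty : ∀ {n} (s : Vec Bool n) q → T (lookup s q) → T (not (isEmpty s))
lookup⇒nonempty (true  ∷ s) _       _ = _
lookup⇒nonempty (false ∷ s) (suc q) t = lookup⇒nonempty s q t

_≟ₛ_ : ∀ {n} → DecidableEquality (NonemptySubset n)
_≟ₛ_ = Product.≡-dec (Vec.≡-dec Bool._≟_) (λ p q → yes (T-irrelevant p q))

module Gadget {d m K : ℕ} (z : Fin m → Fin d → ℤ) (∣z∣≤K : ∀ j i → ∣ z j i ∣ ≤ K) where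

  a b : Fin m → Fin d → ℕ
  a j i = positivePart (z j i)
  b j i = negativePart (z j i)

  Coord : Set
  Coord = ⊤ ⊎ Fin m ⊎ Fin d ⊎ Fin d ⊎ Fin d × Fin K ⊎ Fin d × Fin K

  pattern cu       = inj₁ tt
  pattern ct j     = inj₂ (inj₁ j)
  pattern cr i     = inj₂ (inj₂ (inj₁ i))
  pattern cn i     = inj₂ (inj₂ (inj₂ (inj₁ i)))
  pattern cz i k   = inj₂ (inj₂ (inj₂ (inj₂ (inj₁ (i , k)))))
  pattern cy i k   = inj₂ (inj₂ (inj₂ (inj₂ (inj₂ (i , k)))))

  dim : ℕ
  dim = 1 ℕ.+ (m ℕ.+ (d ℕ.+ (d ℕ.+ (d ℕ.* K ℕ.+ d ℕ.* K))))

  Fin↔Coord : Fin dim ↔ Coord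
  Fin↔Coord = ↔-trans +↔⊎ (1↔⊤ ⊎-↔ ↔-trans +↔⊎ (↔-refl ⊎-↔ ↔-trans +↔⊎ (↔-refl ⊎-↔
              ↔-trans +↔⊎ (↔-refl ⊎-↔ ↔-trans +↔⊎ (*↔× ⊎-↔ *↔×)))))

  open Inverse Fin↔Coord using ()
    renaming (to to coordinate; from to index; strictlyInverseˡ to coordinate-index;
              strictlyInverseʳ to index-coordinate)

  E : Set
  E = NonemptySubset dim

  subset : (g : Coord → Bool) (c : Coord) → T (g c) → E
  subset g c gc = tabulate (g ∘ coordinate) , lookup⇒nonempty _ (index c) (subst T (sym lookup-index) gc)
    where
    lookup-index : lookup (tabulate (g ∘ coordinate)) (index c) ≡ g c
    lookup-index = trans (Vec.lookup∘tabulate (g ∘ coordinate) (index c)) (cong g (coordinate-index c))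

  χ-subset : ∀ g {c} gc c′ → χ (subset g c gc) (index c′) ≡ bit (g c′)
  χ-subset g gc c′ =
    cong bit (trans (Vec.lookup∘tabulate (g ∘ coordinate) (index c′)) (cong g (coordinate-index c′)))

  subset-injective : ∀ {g g′ c c′ gc gc′} → subset g c gc ≡ subset g′ c′ gc′ → ∀ c″ → g c″ ≡ g′ c″
  subset-injective {g} {g′} {gc = gc} {gc′} eq c″ =
    bit-injective (trans (sym (χ-subset g gc c″))
                         (trans (cong (λ e → χ e (index c″)) eq) (χ-subset g′ gc′ c″)))

  Basis : Set
  Basis = ⊤ ⊎ Fin m ⊎ Fin d × Fin K ⊎ Fin d × Fin K ⊎ Fin d

  -- bu = {u}, bt j = {t j}, brz i k = {r i, z i k}, bny i k = {n i, y i k}, brn i = {r i, n i}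
  pattern bu      = inj₁ tt
  pattern bt j    = inj₂ (inj₁ j)
  pattern brz i k = inj₂ (inj₂ (inj₁ (i , k)))
  pattern bny i k = inj₂ (inj₂ (inj₂ (inj₁ (i , k))))
  pattern brn i   = inj₂ (inj₂ (inj₂ (inj₂ i)))

  Fin↔Basis : Fin (1 ℕ.+ (m ℕ.+ (d ℕ.* K ℕ.+ (d ℕ.* K ℕ.+ d)))) ↔ Basis
  Fin↔Basis = ↔-trans +↔⊎ (1↔⊤ ⊎-↔ ↔-trans +↔⊎ (↔-refl ⊎-↔ ↔-trans +↔⊎ (*↔× ⊎-↔
              ↔-trans +↔⊎ (*↔× ⊎-↔ ↔-refl))))

  _≟ᴮ_ : DecidableEquality Basis
  _≟ᴮ_ = Sum.≡-dec Unit._≟_ (Sum.≡-dec Fin._≟_ (Sum.≡-dec Fin×Fin-≟ (Sum.≡-dec Fin×Fin-≟ Fin._≟_)))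
    where
    Fin×Fin-≟ : DecidableEquality (Fin d × Fin K)
    Fin×Fin-≟ = Product.≡-dec Fin._≟_ Fin._≟_

  open Enumeration Fin↔Basis using () renaming (enumeration to allBasis; enumeration-unique to allBasis-unique;
                                                 ∈-enumeration to ∈-allBasis)
  open Indicator _≟ᴮ_ using (δ; bit-∈; ∑-*bit-∈)
  open import Data.List.Membership.DecPropositional _≟ᴮ_ using () renaming (_∈?_ to _∈ᴮ?_)
  open import Data.List.Membership.DecPropositional (_≟ₛ_ {dim}) using () renaming (_∈?_ to _∈ᴱ?_)

  ks : List (Fin K)
  ks = allFin K

  incident : Coord → List Basis
  incident cu       = bu ∷ []
  incident (ct j)   = bt j ∷ []
  incident (cr i)   = brn i ∷ map (λ k → brz i k) ks
  incident (cn i)   = brn i ∷ map (λ k → bny i k) ks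
  incident (cz i k) = brz i k ∷ []
  incident (cy i k) = bny i k ∷ []

  incident-unique : ∀ c → Unique (incident c)
  incident-unique cu       = [] ∷ []
  incident-unique (ct j)   = [] ∷ []
  incident-unique (cr i)   = AllP.map⁺ (All.universal (λ _ ()) ks) ∷ Unique.map⁺ (λ { refl → refl }) (Unique.allFin⁺ K)
  incident-unique (cn i)   = AllP.map⁺ (All.universal (λ _ ()) ks) ∷ Unique.map⁺ (λ { refl → refl }) (Unique.allFin⁺ K)
  incident-unique (cz i k) = [] ∷ []
  incident-unique (cy i k) = [] ∷ []

  key : Basis → Coord
  key bu        = cu
  key (bt j)    = ct j
  key (brz i k) = cz i k
  key (bny i k) = cy i k
  key (brn i)   = cn i

  key-incident : ∀ β → β ∈ incident (key β)
  key-incident bu        = here refl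
  key-incident (bt j)    = here refl
  key-incident (brz i k) = here refl
  key-incident (bny i k) = here refl
  key-incident (brn i)   = here refl

  support : Basis → Coord → Bool
  support β c = does (β ∈ᴮ? incident c)

  key-support : ∀ β → T (support β (key β))
  key-support β = T-does⁺ (β ∈ᴮ? incident (key β)) (key-incident β)

  basisVector : Basis → E
  basisVector β = subset (support β) (key β) (key-support β)

  basisList : List E
  basisList = map basisVector allBasis

  columnSupport : Fin m → Coord → Bool
  columnSupport j cu       = true
  columnSupport j (ct j′)  = does (j Fin.≟ j′)
  columnSupport j (cr _)   = false
  columnSupport j (cn _)   = false
  columnSupport j (cz i k) = toℕ k <ᵇ b j i
  columnSupport j (cy i k) = toℕ k <ᵇ a j i

  column : Fin m → E
  column j = subset (columnSupport j) cu tt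

  Φ : Fin d → (Fin dim → ℚ) → ℚ
  Φ i x = x (index (cr i)) - x (index (cn i))
          - ∑ ks (λ k → x (index (cz i k))) + ∑ ks (λ k → x (index (cy i k)))

  ψ : Basis → (Fin dim → ℚ) → ℚ
  ψ (brn i) x = x (index (cn i)) - ∑ ks (λ k → x (index (cy i k)))
  ψ β       x = x (index (key β))

  Φ-linear : ∀ i → Linear (Φ i)
  Φ-linear i =
    +-linear (+-linear (+-linear (projection-linear (index (cr i))) (neg-linear (projection-linear (index (cn i)))))
                       (neg-linear (∑-linear ks (λ k → projection-linear (index (cz i k))))))
             (∑-linear ks (λ k → projection-linear (index (cy i k))))

  Φ-cong : ∀ i → Congruent (Φ i)
  Φ-cong i x≗y = cong₂ _+_ (cong₂ _-_ (cong₂ _-_ (x≗y _) (x≗y _)) (∑-congˡ ks (λ k → x≗y (index (cz i k)))))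
                           (∑-congˡ ks (λ k → x≗y (index (cy i k))))

  ψ-linear : ∀ β → Linear (ψ β)
  ψ-linear bu        = projection-linear (index cu)
  ψ-linear (bt j)    = projection-linear (index (ct j))
  ψ-linear (brz i k) = projection-linear (index (cz i k))
  ψ-linear (bny i k) = projection-linear (index (cy i k))
  ψ-linear (brn i)   = +-linear (projection-linear (index (cn i)))
                                (neg-linear (∑-linear ks (λ k → projection-linear (index (cy i k)))))

  ψ-cong : ∀ β → Congruent (ψ β)
  ψ-cong bu        x≗y = x≗y _
  ψ-cong (bt j)    x≗y = x≗y _
  ψ-cong (brz i k) x≗y = x≗y _
  ψ-cong (bny i k) x≗y = x≗y _
  ψ-cong (brn i)   x≗y = cong₂ _-_ (x≗y _) (∑-congˡ ks (λ k → x≗y (index (cy i k))))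

  χ-basisVector-support : ∀ β c → χ (basisVector β) (index c) ≡ bit (support β c)
  χ-basisVector-support β = χ-subset (support β) {key β} (key-support β)

  χ-basisVector : ∀ β c → χ (basisVector β) (index c) ≡ ∑ (incident c) (δ β)
  χ-basisVector β c = trans (χ-basisVector-support β c) (bit-∈ (incident c) (incident-unique c))

  χ-basisVector-leaf : ∀ β c {β₀} → incident c ≡ β₀ ∷ [] → χ (basisVector β) (index c) ≡ δ β β₀
  χ-basisVector-leaf β c {β₀} incident≡ =
    trans (χ-basisVector β c) (trans (cong (λ L → ∑ L (δ β)) incident≡) (+-identityʳ (δ β β₀)))

  χ-basisVector-r : ∀ β i → χ (basisVector β) (index (cr i)) ≡ δ β (brn i) + ∑ ks (λ k → δ β (brz i k))
  χ-basisVector-r β i = trans (χ-basisVector β (cr i)) (cong (δ β (brn i) +_) (∑-map ks _ (δ β)))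

  χ-basisVector-n : ∀ β i → χ (basisVector β) (index (cn i)) ≡ δ β (brn i) + ∑ ks (λ k → δ β (bny i k))
  χ-basisVector-n β i = trans (χ-basisVector β (cn i)) (cong (δ β (brn i) +_) (∑-map ks _ (δ β)))

  ψ-dual : ∀ β β′ → ψ β (χ (basisVector β′)) ≡ δ β′ β
  ψ-dual bu        β′ = χ-basisVector-leaf β′ cu refl
  ψ-dual (bt j)    β′ = χ-basisVector-leaf β′ (ct j) refl
  ψ-dual (brz i k) β′ = χ-basisVector-leaf β′ (cz i k) refl
  ψ-dual (bny i k) β′ = χ-basisVector-leaf β′ (cy i k) refl
  ψ-dual (brn i)   β′ = begin
    χ (basisVector β′) (index (cn i)) - ∑ ks (λ k → χ (basisVector β′) (index (cy i k)))
      ≡⟨ cong₂ _-_ (χ-basisVector-n β′ i) (∑-congˡ ks (λ k → χ-basisVector-leaf β′ (cy i k) refl)) ⟩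
    δ β′ (brn i) + ∑ ks (λ k → δ β′ (bny i k)) - ∑ ks (λ k → δ β′ (bny i k))
      ≡⟨ solve 2 (λ x y → x :+ y :- y := x) refl (δ β′ (brn i)) (∑ ks (λ k → δ β′ (bny i k))) ⟩
    δ β′ (brn i) ∎
    where open ≡-Reasoning

  Φ-basisVector : ∀ β i → Φ i (χ (basisVector β)) ≡ 0ℚ
  Φ-basisVector β i = begin
    Φ i (χ (basisVector β))
      ≡⟨ cong₂ _+_ (cong₂ _-_ (cong₂ _-_ (χ-basisVector-r β i) (χ-basisVector-n β i))
                              (∑-congˡ ks (λ k → χ-basisVector-leaf β (cz i k) refl)))
                   (∑-congˡ ks (λ k → χ-basisVector-leaf β (cy i k) refl)) ⟩
    δ β (brn i) + Z - (δ β (brn i) + Y) - Z + Y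
      ≡⟨ solve 3 (λ x z y → x :+ z :- (x :+ y) :- z :+ y := con 0ℚ) refl (δ β (brn i)) Z Y ⟩
    0ℚ ∎
    where
    open ≡-Reasoning
    Z = ∑ ks (λ k → δ β (brz i k))
    Y = ∑ ks (λ k → δ β (bny i k))

  Φ-column : ∀ j i → Φ i (χ (column j)) ≡ fromℤ (z j i)
  Φ-column j i = begin
    Φ i (χ (column j))
      ≡⟨ cong₂ _+_ (cong₂ _-_ (cong₂ _-_ (χ-column (cr i)) (χ-column (cn i))) (∑-congˡ ks (χ-column ∘ cz i)))
                   (∑-congˡ ks (χ-column ∘ cy i)) ⟩
    0ℚ - 0ℚ - ∑ ks (λ k → bit (toℕ k <ᵇ b j i)) + ∑ ks (λ k → bit (toℕ k <ᵇ a j i))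
      ≡⟨ cong₂ (λ B A → 0ℚ - 0ℚ - B + A) (∑-bits-below K (b j i) b≤K) (∑-bits-below K (a j i) a≤K) ⟩
    0ℚ - 0ℚ - fromℤ (ℤ.+ b j i) + fromℤ (ℤ.+ a j i)
      ≡⟨ solve 2 (λ B A → con 0ℚ :- con 0ℚ :- B :+ A := A :- B) refl (fromℤ (ℤ.+ b j i)) (fromℤ (ℤ.+ a j i)) ⟩
    fromℤ (ℤ.+ a j i) - fromℤ (ℤ.+ b j i)
      ≡⟨ sym (fromℤ≡parts (z j i)) ⟩
    fromℤ (z j i) ∎
    where
    open ≡-Reasoning
    a≤K : a j i ≤ K
    a≤K = ℕ.≤-trans (positivePart≤∣∣ (z j i)) (∣z∣≤K j i)
    b≤K : b j i ≤ K
    b≤K = ℕ.≤-trans (negativePart≤∣∣ (z j i)) (∣z∣≤K j i)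
    χ-column : ∀ c → χ (column j) (index c) ≡ bit (columnSupport j c)
    χ-column = χ-subset (columnSupport j) {cu} tt

  basisVector-injective : ∀ {β β′} → basisVector β ≡ basisVector β′ → β ≡ β′
  basisVector-injective = Biorthogonal.b-injective _≟ᴮ_ χ basisVector ψ ψ-linear ψ-cong ψ-dual

  basisList-unique : Unique basisList
  basisList-unique = Unique.map⁺ basisVector-injective allBasis-unique

  basisList-independent : LinIndep χ (λ e → does (e ∈ᴱ? basisList))
  basisList-independent = Biorthogonal.image-independent _≟ᴮ_ χ basisVector ψ ψ-linear ψ-cong ψ-dual _ preimage
    where
    preimage : ∀ {e} → T (does (e ∈ᴱ? basisList)) → ∃[ β ] basisVector β ≡ e
    preimage {e} e∈ with ∈-map⁻ basisVector (T-does⁻ (e ∈ᴱ? basisList) e∈)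
    ... | β , _ , e≡ = β , sym e≡

  Φ-basisList : ∀ {e} → e ∈ basisList → ∀ i → Φ i (χ e) ≡ 0ℚ
  Φ-basisList e∈ i with ∈-map⁻ basisVector e∈
  ... | β , _ , refl = Φ-basisVector β i

  module _ (x : Fin dim → ℚ) (Φx≡0 : ∀ i → Φ i x ≡ 0ℚ) where

    ψ-incident : ∀ c → ∑ (incident c) (λ β → ψ β x) ≡ x (index c)
    ψ-incident cu       = +-identityʳ _
    ψ-incident (ct j)   = +-identityʳ _
    ψ-incident (cz i k) = +-identityʳ _
    ψ-incident (cy i k) = +-identityʳ _
    ψ-incident (cr i)   = begin
      ψ (brn i) x + ∑ (map (λ k → brz i k) ks) (λ β → ψ β x)
        ≡⟨ cong (ψ (brn i) x +_) (∑-map ks _ (λ β → ψ β x)) ⟩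
      xn - Y + Z
        ≡⟨ solve 4 (λ r n z y → n :- y :+ z := r :- (r :- n :- z :+ y)) refl xr xn Z Y ⟩
      xr - Φ i x
        ≡⟨ cong (λ y → xr - y) (Φx≡0 i) ⟩
      xr - 0ℚ
        ≡⟨ solve 1 (λ r → r :- con 0ℚ := r) refl xr ⟩
      xr ∎
      where
      open ≡-Reasoning
      xr = x (index (cr i))
      xn = x (index (cn i))
      Z = ∑ ks (λ k → x (index (cz i k)))
      Y = ∑ ks (λ k → x (index (cy i k)))
    ψ-incident (cn i)   = begin
      ψ (brn i) x + ∑ (map (λ k → bny i k) ks) (λ β → ψ β x)
        ≡⟨ cong (ψ (brn i) x +_) (∑-map ks _ (λ β → ψ β x)) ⟩
      xn - Y + Y
        ≡⟨ solve 2 (λ n y → n :- y :+ y := n) refl xn Y ⟩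
      xn ∎
      where
      open ≡-Reasoning
      xn = x (index (cn i))
      Y = ∑ ks (λ k → x (index (cy i k)))

  kernel-spanned : ∀ x → (∀ i → Φ i x ≡ 0ℚ) → Σ[ α ∈ (E → ℚ) ] ∀ q → x q ≡ lincomb χ α basisList q
  kernel-spanned x Φx≡0 = α , spanned
    where
    α : E → ℚ
    α = extendAlong _≟ₛ_ basisVector basisVector-injective allBasis (λ β → ψ β x)

    α-basisVector : ∀ β → α (basisVector β) ≡ ψ β x
    α-basisVector β = extendAlong-apply _≟ₛ_ basisVector basisVector-injective allBasis _ (∈-allBasis β)

    spanned : ∀ q → x q ≡ lincomb χ α basisList q
    spanned q = begin
      x q
        ≡⟨ cong x (sym (index-coordinate q)) ⟩
      x (index c)
        ≡⟨ sym (ψ-incident x Φx≡0 c) ⟩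
      ∑ (incident c) (λ β → ψ β x)
        ≡⟨ sym (∑-*bit-∈ allBasis (incident c) _ allBasis-unique (incident-unique c) (λ {β} _ → ∈-allBasis β)) ⟩
      ∑ allBasis (λ β → ψ β x * bit (support β c))
        ≡⟨ ∑-congˡ allBasis (λ β → cong₂ _*_ (sym (α-basisVector β)) (sym (χ-basisVector-support β c))) ⟩
      ∑ allBasis (λ β → α (basisVector β) * χ (basisVector β) (index c))
        ≡⟨ sym (∑-map allBasis basisVector (λ e → α e * χ e (index c))) ⟩
      lincomb χ α basisList (index c)
        ≡⟨ cong (lincomb χ α basisList) (index-coordinate q) ⟩
      lincomb χ α basisList q ∎
      where
      open ≡-Reasoning
      c = coordinate q

  column-injective : ∀ {j j′} → column j ≡ column j′ → j ≡ j′
  column-injective {j} {j′} eq = sym (T-does⁻ (j′ Fin.≟ j) (subst T same-tⱼ (T-does⁺ (j Fin.≟ j) refl)))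
    where
    same-tⱼ : columnSupport j (ct j) ≡ columnSupport j′ (ct j)
    same-tⱼ = subset-injective {columnSupport j} {columnSupport j′} {cu} {cu} {tt} {tt} eq (ct j)

  column∉basisList : ∀ j → column j ∉ basisList
  column∉basisList j col∈ with ∈-map⁻ basisVector col∈
  ... | β , _ , col≡β = u-and-t (in-incident cu tt) (in-incident (ct j) (T-does⁺ (j Fin.≟ j) refl))
    where
    in-incident : ∀ c → T (columnSupport j c) → β ∈ incident c
    in-incident c t = T-does⁻ (β ∈ᴮ? incident c) (subst T (same-support c) t)
      where
      same-support : ∀ c → columnSupport j c ≡ support β c
      same-support = subset-injective {columnSupport j} {support β} {cu} {key β} {tt} {key-support β} col≡β

    u-and-t : β ∈ incident cu → β ∈ incident (ct j) → ⊥
    u-and-t (here refl) (here ())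

  realisedInResonance : (v : Fin m → Fin d → ℚ) (scale : Fin m → ℚ) → (∀ j → NonZero (scale j)) →
                        (∀ j i → scale j * v j i ≡ fromℤ (z j i)) →
                        Σ[ N ∈ SetSystem ] (Minor (resonance dim) N × (repMatroid d m v ≅ N))
  realisedInResonance v scale scale≢0 scale*v≡z =
    Transfer.realisedAsMinor _≟ₛ_ χ v Φ Φ-linear Φ-cong basisList basisList-unique basisList-independent
      Φ-basisList kernel-spanned column column-injective column∉basisList scale scale≢0
      (λ j i → trans (Φ-column j i) (sym (scale*v≡z j i)))

theorem1p2 : (d m : ℕ) (v : Fin m → Fin d → ℚ) →
    ∃[ n ] Σ[ N ∈ SetSystem ] (Minor (resonance n) N × (repMatroid d m v ≅ N))
theorem1p2 d m v =
  dim , realisedInResonance v scale (λ j → denominator≢0 (cleared j)) (λ j → denominator*u≡numerator (cleared j))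
  where
  open CommonDenominator

  cleared : ∀ j → CommonDenominator (v j)
  cleared j = commonDenominator (v j)

  scale : Fin m → ℚ
  scale j = fromℤ (ℤ.+ denominator (cleared j))

  z : Fin m → Fin d → ℤ
  z j = numerator (cleared j)

  open Gadget z (proj₂ (bounded₂ (λ j i → ∣ z j i ∣)))
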